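{- Let $G$ be a finite connected simple undirected graph and $v_0\in V(G)$ such that: the graph $G\setminus\{v_0\}$ (obtained by deleting $v_0$) is connected; every simple cycle of $G$ has length at most $4$; every vertex of $G$ is at distance at most $2$ from $v_0$. Let $N_{v_0}$ be the set of vertices at distance $1$ from $v_0$, and assume $|N_{v_0}|\ge 3$. If every $v\in N_{v_0}$ has degree $2$ in $G$, then $V(G)\setminus(N_{v_0}\cup\{v_0\})=\{v_x\}$ for a single vertex $v_x$, and $G$ is the molecule $\theta^{0,|N_{v_0}|}_{v_0,v_x}$.
   Context: For distinct vertices $a,b$, $\varepsilon\in\{0,1\}$ and $n\ge 0$, the molecule $\theta^{\varepsilon,n}_{a,b}$ is the simple undirected graph with vertex set $\{a,b,u_1,\dots,u_n\}$ whose edges are $\{a,u_i\}$ and $\{u_i,b\}$ for $i=1,\dots,n$, together with the edge $\{a,b\}$ if $\varepsilon=1$ (and no other edges). Thus $\theta^{0,n}_{a,b}$ consists of $n$ internally disjoint paths of length $2$ between $a$ and $b$. -}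

module Defs where

open import Data.Nat using (ℕ; zero; suc; _+_; _≤_)
open import Data.Fin using (Fin; zero; suc; fromℕ; inject₁)
open import Data.Bool using (Bool; true; false; _∧_; _∨_; not; if_then_else_)
open import Data.Product using (Σ; ∃; _×_; _,_)
open import Relation.Binary.PropositionalEquality using (_≡_; _≢_; refl)
open import Function.Bundles using (_↔_; Inverse)

record Graph (n : ℕ) : Set where
  field
    adj    : Fin n → Fin n → Bool
    sym    : ∀ x y → adj x y ≡ adj y x
    irrefl : ∀ x → adj x x ≡ false

open Graph public

Edge : ∀ {n} → Graph n → Fin n → Fin n → Set
Edge G x y = adj G x y ≡ true

record Walk {n : ℕ} (G : Graph n) (k : ℕ) (u v : Fin n) : Set where
  field
    vert  : Fin (suc k) → Fin n
    start : vert zero ≡ u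
    end   : vert (fromℕ k) ≡ v
    step  : ∀ (i : Fin k) → Edge G (vert (inject₁ i)) (vert (suc i))

open Walk public

Connected : ∀ {n} → Graph n → Set
Connected {n} G = ∀ (u v : Fin n) → ∃ λ k → Walk G k u v

ConnectedWithout : ∀ {n} → Graph n → Fin n → Set
ConnectedWithout {n} G x =
  ∀ (u v : Fin n) → u ≢ x → v ≢ x →
    Σ ℕ λ k → Σ (Walk G k u v) λ w → ∀ i → vert w i ≢ x

Dist : ∀ {n} → Graph n → Fin n → Fin n → ℕ → Set
Dist G u v d = Walk G d u v × (∀ m → Walk G m u v → d ≤ m)

DistLE : ∀ {n} → Graph n → Fin n → Fin n → ℕ → Set
DistLE G u v d = ∃ λ e → Dist G u v e × e ≤ d

record SimpleCycle {n : ℕ} (G : Graph n) (L : ℕ) : Set where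
  field
    base     : Fin n
    walk     : Walk G L base base
    len≥3    : 3 ≤ L
    distinct : ∀ (i j : Fin L) → vert walk (inject₁ i) ≡ vert walk (inject₁ j) → i ≡ j

countTrue : ∀ {n} → (Fin n → Bool) → ℕ
countTrue {zero}  f = 0
countTrue {suc n} f = (if f zero then 1 else 0) + countTrue (λ i → f (suc i))

deg : ∀ {n} → Graph n → Fin n → ℕ
deg G v = countTrue (adj G v)

-- The molecule θ^{ε,k}_{a,b} on vertex set Fin (2 + k):
-- vertex 0 is a, vertex 1 is b, vertices 2+i are u_{i+1}.
-- Edges: {a,u_i}, {u_i,b} for all i, and {a,b} iff ε = true.
thetaAdj : (ε : Bool) (k : ℕ) → Fin (2 + k) → Fin (2 + k) → Bool
thetaAdj ε k zero          zero          = false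
thetaAdj ε k zero          (suc zero)    = ε
thetaAdj ε k zero          (suc (suc _)) = true
thetaAdj ε k (suc zero)    zero          = ε
thetaAdj ε k (suc zero)    (suc zero)    = false
thetaAdj ε k (suc zero)    (suc (suc _)) = true
thetaAdj ε k (suc (suc _)) zero          = true
thetaAdj ε k (suc (suc _)) (suc zero)    = true
thetaAdj ε k (suc (suc _)) (suc (suc _)) = false

theta : (ε : Bool) (k : ℕ) → Graph (2 + k)
theta ε k = record { adj = thetaAdj ε k ; sym = s ; irrefl = r }
  where
  s : ∀ x y → thetaAdj ε k x y ≡ thetaAdj ε k y x
  s zero          zero          = refl
  s zero          (suc zero)    = refl
  s zero          (suc (suc _)) = refl
  s (suc zero)    zero          = refl
  s (suc zero)    (suc zero)    = refl
  s (suc zero)    (suc (suc _)) = refl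
  s (suc (suc _)) zero          = refl
  s (suc (suc _)) (suc zero)    = refl
  s (suc (suc _)) (suc (suc _)) = refl
  r : ∀ x → thetaAdj ε k x x ≡ false
  r zero          = refl
  r (suc zero)    = refl
  r (suc (suc _)) = refl

IsTheta : ∀ {n} → Graph n → (ε : Bool) (k : ℕ) → Fin n → Fin n → Set
IsTheta {n} G ε k a b =
  Σ (Fin (2 + k) ↔ Fin n) λ f →
    Inverse.to f zero ≡ a × Inverse.to f (suc zero) ≡ b ×
    (∀ x y → adj G (Inverse.to f x) (Inverse.to f y) ≡ thetaAdj ε k x y)

-- Every a ∈ N has exactly one neighbour s(a) other than v₀. There is no edge inside N:
-- otherwise, for an edge ab, the set {a, b} is closed under steps avoiding v₀, so a third
-- member of N could not be reached from a in G − v₀. If s(a) ≠ s(b) were adjacent,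
-- v₀ a s(a) s(b) b would be a 5-cycle. Hence, for x = s(a₀), the set of x and of the
-- b ∈ N with s(b) = x is closed under steps avoiding v₀, so it contains all of N; as
-- every vertex lies within distance 2 of v₀, the only vertex outside N ∪ {v₀} is x.
module Submission where

open import Defs hiding (sym)
open import Data.Nat using (ℕ; zero; suc; _+_; _≤_; _<_; z≤n; s≤s; s≤s⁻¹)
open import Data.Nat.Properties
  using (+-cancelˡ-<; m≤n⇒m≤1+n; ≤-reflexive; ≤-trans; ≤-<-trans; <⇒≱; <-irrefl; n<1+n; module ≤-Reasoning)
open import Data.Fin using (Fin; zero; suc; inject₁; fromℕ; punchIn; punchOut)
open import Data.Fin.Properties using (_≟_; punchIn-punchOut)
open import Data.Fin.Induction using (<-weakInduction)
open import Data.Fin.Permutation using (Permutation; insert; id; _⟨$⟩ʳ_; insert-punchIn)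
open import Data.Fin.Subset using (Subset; inside; outside; _∈_; _∉_; _⊆_; ∣_∣; ⊤; ⁅_⁆; _-_; Nonempty)
open import Data.Fin.Subset.Properties
  using (p─⊥≡p; p─q⊆p; x∈p∧x≢y⇒x∈p-y; x∈p⇒∣p-x∣<∣p∣; nonempty?; Empty-unique; ∣⊥∣≡0; ∣⊤∣≡n; ∈⊤; ⊆-antisym)
open import Data.Bool using (Bool; true; false)
open import Data.Bool.Properties using (¬-not)
open import Data.Vec.Base using (Vec; _∷_; []; here; there; tabulate; lookup; head; _∷ʳ_)
open import Data.Vec.Properties using (lookup∘tabulate; []=⇒lookup; lookup⇒[]=)
open import Data.Vec.Relation.Unary.All using (_∷_; [])
open import Data.Vec.Relation.Unary.AllPairs using (_∷_; [])
open import Data.Vec.Relation.Unary.Unique.Propositional using (Unique)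
open import Data.Vec.Relation.Unary.Unique.Propositional.Properties using (lookup-injective)
open import Data.Product using (Σ; ∃; _×_; _,_; proj₁; proj₂)
open import Data.Sum using (_⊎_; inj₁; inj₂)
open import Function using (_∘_)
open import Function.Bundles using (Injection)
open import Function.Properties.Inverse using (↔⇒↣)
open import Relation.Binary.PropositionalEquality
open import Relation.Nullary using (¬_; yes; no; contradiction)

private variable
  A : Set
  n k : ℕ

lookup-∷ʳ-inject₁ : ∀ (xs : Vec A n) x i → lookup (xs ∷ʳ x) (inject₁ i) ≡ lookup xs i
lookup-∷ʳ-inject₁ (y ∷ xs) x zero    = refl
lookup-∷ʳ-inject₁ (y ∷ xs) x (suc i) = lookup-∷ʳ-inject₁ xs x i

lookup-∷ʳ-fromℕ : ∀ (xs : Vec A n) x → lookup (xs ∷ʳ x) (fromℕ n) ≡ x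
lookup-∷ʳ-fromℕ []       x = refl
lookup-∷ʳ-fromℕ (y ∷ xs) x = lookup-∷ʳ-fromℕ xs x

x∈p∧y∉p⇒x≢y : ∀ {p : Subset n} {x y} → x ∈ p → y ∉ p → x ≢ y
x∈p∧y∉p⇒x≢y x∈p y∉p refl = y∉p x∈p

x∈p-y⇒x∈p : ∀ {p : Subset n} {x y} → x ∈ p - y → x ∈ p
x∈p-y⇒x∈p {p = p} {y = y} = p─q⊆p p ⁅ y ⁆

x∈p-y⇒x≢y : ∀ {p : Subset n} {x y} → x ∈ p - y → x ≢ y
x∈p-y⇒x≢y {p = _ ∷ _} {suc x} (there x∈p-x) refl = x∈p-y⇒x≢y x∈p-x refl

∣p∣≡1+∣p-x∣ : ∀ {p : Subset n} {x} → x ∈ p → ∣ p ∣ ≡ suc ∣ p - x ∣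
∣p∣≡1+∣p-x∣ {p = inside ∷ p}  {zero}  here        = cong suc (cong ∣_∣ (sym (p─⊥≡p p)))
∣p∣≡1+∣p-x∣ {p = inside ∷ p}  {suc x} (there x∈p) = cong suc (∣p∣≡1+∣p-x∣ x∈p)
∣p∣≡1+∣p-x∣ {p = outside ∷ p} {suc x} (there x∈p) = ∣p∣≡1+∣p-x∣ x∈p

∣p∣≤1+∣p-x∣ : ∀ (p : Subset n) x → ∣ p ∣ ≤ suc ∣ p - x ∣
∣p∣≤1+∣p-x∣ (inside ∷ p)  zero    = ≤-reflexive (cong suc (cong ∣_∣ (sym (p─⊥≡p p))))
∣p∣≤1+∣p-x∣ (outside ∷ p) zero    = m≤n⇒m≤1+n (≤-reflexive (cong ∣_∣ (sym (p─⊥≡p p))))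
∣p∣≤1+∣p-x∣ (inside ∷ p)  (suc x) = s≤s (∣p∣≤1+∣p-x∣ p x)
∣p∣≤1+∣p-x∣ (outside ∷ p) (suc x) = ∣p∣≤1+∣p-x∣ p x

Nonempty⇒∣p∣>0 : ∀ {p : Subset n} → Nonempty p → 0 < ∣ p ∣
Nonempty⇒∣p∣>0 (_ , x∈p) = ≤-<-trans z≤n (x∈p⇒∣p-x∣<∣p∣ x∈p)

∣p∣>0⇒Nonempty : ∀ {p : Subset n} → 0 < ∣ p ∣ → Nonempty p
∣p∣>0⇒Nonempty {n} {p} 0<∣p∣ with nonempty? p
... | yes p≠∅ = p≠∅
... | no  p=∅ = contradiction (trans (cong ∣_∣ (Empty-unique p=∅)) (∣⊥∣≡0 n))
                              (λ ∣p∣≡0 → <-irrefl (sym ∣p∣≡0) 0<∣p∣)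

∣p∣≤1⇒unique : ∀ {p : Subset n} {x y} → ∣ p ∣ ≤ 1 → x ∈ p → y ∈ p → x ≡ y
∣p∣≤1⇒unique {p = p} {x} {y} ∣p∣≤1 x∈p y∈p with x ≟ y
... | yes x≡y = x≡y
... | no  x≢y = contradiction ∣p∣≤1 (<⇒≱ (begin-strict
  1                ≤⟨ Nonempty⇒∣p∣>0 (y , x∈p∧x≢y⇒x∈p-y y∈p (x≢y ∘ sym)) ⟩
  ∣ p - x ∣        <⟨ n<1+n _ ⟩
  suc ∣ p - x ∣    ≡⟨ ∣p∣≡1+∣p-x∣ x∈p ⟨
  ∣ p ∣            ∎))
  where open ≤-Reasoning

∃∈-avoiding₂ : ∀ {p : Subset n} → 2 < ∣ p ∣ → ∀ a b → ∃ λ c → c ∈ p × c ≢ a × c ≢ b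
∃∈-avoiding₂ {p = p} 2<∣p∣ a b with ∣p∣>0⇒Nonempty {p = p - a - b} 0<∣p-a-b∣
  where
  0<∣p-a-b∣ : 0 < ∣ p - a - b ∣
  0<∣p-a-b∣ = +-cancelˡ-< 2 _ _ (begin-strict
    2                   <⟨ 2<∣p∣ ⟩
    ∣ p ∣               ≤⟨ ∣p∣≤1+∣p-x∣ p a ⟩
    suc ∣ p - a ∣       ≤⟨ s≤s (∣p∣≤1+∣p-x∣ (p - a) b) ⟩
    2 + ∣ p - a - b ∣   ∎)
    where open ≤-Reasoning
... | c , c∈p-a-b = c , x∈p-y⇒x∈p (x∈p-y⇒x∈p c∈p-a-b) , x∈p-y⇒x≢y (x∈p-y⇒x∈p c∈p-a-b) , x∈p-y⇒x≢y c∈p-a-b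

n≡2+∣p∣ : ∀ {p : Subset n} {x y} → x ≢ y → x ∉ p → y ∉ p →
  (∀ c → c ≢ x → c ≢ y → c ∈ p) → n ≡ 2 + ∣ p ∣
n≡2+∣p∣ {n} {p} {x} {y} x≢y x∉p y∉p others∈p = begin
  n                   ≡⟨ ∣⊤∣≡n n ⟨
  ∣ ⊤ {n} ∣           ≡⟨ ∣p∣≡1+∣p-x∣ (∈⊤ {x = x}) ⟩
  suc ∣ ⊤ {n} - x ∣   ≡⟨ cong suc (∣p∣≡1+∣p-x∣ (x∈p∧x≢y⇒x∈p-y (∈⊤ {x = y}) (x≢y ∘ sym))) ⟩
  2 + ∣ ⊤ - x - y ∣   ≡⟨ cong (λ q → 2 + ∣ q ∣) (⊆-antisym ⊤-x-y⊆p p⊆⊤-x-y) ⟩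
  2 + ∣ p ∣           ∎
  where
  open ≡-Reasoning
  p⊆⊤-x-y : p ⊆ ⊤ - x - y
  p⊆⊤-x-y c∈p = x∈p∧x≢y⇒x∈p-y (x∈p∧x≢y⇒x∈p-y ∈⊤ λ { refl → x∉p c∈p }) λ { refl → y∉p c∈p }
  ⊤-x-y⊆p : ⊤ - x - y ⊆ p
  ⊤-x-y⊆p {c} c∈⊤-x-y = others∈p c (x∈p-y⇒x≢y (x∈p-y⇒x∈p c∈⊤-x-y)) (x∈p-y⇒x≢y c∈⊤-x-y)

countTrue≡∣tabulate∣ : ∀ (f : Fin n → Bool) → countTrue f ≡ ∣ tabulate f ∣
countTrue≡∣tabulate∣ {zero}  f = refl
countTrue≡∣tabulate∣ {suc n} f with f zero
... | true  = cong suc (countTrue≡∣tabulate∣ (f ∘ suc))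
... | false = countTrue≡∣tabulate∣ (f ∘ suc)

permutation-0↦a-1↦b : ∀ {a b : Fin n} → n ≡ 2 + k → a ≢ b →
  Σ (Permutation (2 + k) n) λ π → π ⟨$⟩ʳ zero ≡ a × π ⟨$⟩ʳ suc zero ≡ b
permutation-0↦a-1↦b {a = a} refl a≢b = π , refl , (begin
  π ⟨$⟩ʳ suc zero            ≡⟨ insert-punchIn zero a σ zero ⟩
  punchIn a (punchOut a≢b)   ≡⟨ punchIn-punchOut a≢b ⟩
  _                          ∎)
  where
  open ≡-Reasoning
  σ = insert zero (punchOut a≢b) id
  π = insert zero a σ

module _ (G : Graph n) where

  Edge-sym : ∀ {u v} → Edge G u v → Edge G v u
  Edge-sym {u} {v} uv = trans (Graph.sym G v u) uv

  Edge⇒≢ : ∀ {u v} → Edge G u v → u ≢ v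
  Edge⇒≢ {u} uu refl = contradiction (trans (sym uu) (irrefl G u)) λ ()

  neighbours : Fin n → Subset n
  neighbours v = tabulate (adj G v)

  ∈-neighbours⇒Edge : ∀ {u v} → u ∈ neighbours v → Edge G v u
  ∈-neighbours⇒Edge {u} {v} u∈ = trans (sym (lookup∘tabulate (adj G v) u)) ([]=⇒lookup u∈)

  Edge⇒∈-neighbours : ∀ {u v} → Edge G v u → u ∈ neighbours v
  Edge⇒∈-neighbours {u} {v} vu = lookup⇒[]= u _ (trans (lookup∘tabulate (adj G v) u) vu)

  deg≡∣neighbours∣ : ∀ v → deg G v ≡ ∣ neighbours v ∣
  deg≡∣neighbours∣ v = countTrue≡∣tabulate∣ (adj G v)

  other-neighbour : ∀ {v} → 2 ≤ deg G v → ∀ u → ∃ λ w → Edge G v w × w ≢ u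
  other-neighbour {v} 2≤deg u with ∣p∣>0⇒Nonempty {p = neighbours v - u} 0<∣N-u∣
    where
    0<∣N-u∣ : 0 < ∣ neighbours v - u ∣
    0<∣N-u∣ = +-cancelˡ-< 1 _ _ (begin-strict
      1                          <⟨ 2≤deg ⟩
      deg G v                    ≡⟨ deg≡∣neighbours∣ v ⟩
      ∣ neighbours v ∣           ≤⟨ ∣p∣≤1+∣p-x∣ (neighbours v) u ⟩
      suc ∣ neighbours v - u ∣   ∎)
      where open ≤-Reasoning
  ... | w , w∈N-u = w , ∈-neighbours⇒Edge (x∈p-y⇒x∈p w∈N-u) , x∈p-y⇒x≢y w∈N-u

  other-neighbour-unique : ∀ {v u w w′} → deg G v ≤ 2 → Edge G v u →
    Edge G v w → Edge G v w′ → w ≢ u → w′ ≢ u → w ≡ w′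
  other-neighbour-unique {v} {u} deg≤2 vu vw vw′ w≢u w′≢u =
    ∣p∣≤1⇒unique ∣N-u∣≤1 (x∈p∧x≢y⇒x∈p-y (Edge⇒∈-neighbours vw) w≢u)
                          (x∈p∧x≢y⇒x∈p-y (Edge⇒∈-neighbours vw′) w′≢u)
    where
    ∣N-u∣≤1 : ∣ neighbours v - u ∣ ≤ 1
    ∣N-u∣≤1 = s≤s⁻¹ (begin
      suc ∣ neighbours v - u ∣   ≡⟨ ∣p∣≡1+∣p-x∣ (Edge⇒∈-neighbours vu) ⟨
      ∣ neighbours v ∣           ≡⟨ deg≡∣neighbours∣ v ⟨
      deg G v                    ≤⟨ deg≤2 ⟩
      2                          ∎)
      where open ≤-Reasoning

  walk-edge : ∀ {u v} → Walk G 1 u v → Edge G u v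
  walk-edge w = subst₂ (Edge G) (start w) (end w) (step w zero)

  edge-walk : ∀ {u v} → Edge G u v → Walk G 1 u v
  edge-walk {u} {v} uv = record
    { vert = λ { zero → u ; (suc _) → v } ; start = refl ; end = refl ; step = λ { zero → uv } }

  Dist1⇔Edge : ∀ {u v} → (Dist G u v 1 → Edge G u v) × (Edge G u v → Dist G u v 1)
  Dist1⇔Edge = (λ (w , _) → walk-edge w) , λ uv → edge-walk uv , λ
    { zero    w → contradiction (trans (sym (start w)) (end w)) (Edge⇒≢ uv)
    ; (suc m) w → s≤s z≤n }

  DistLE2-cases : ∀ {u v} → DistLE G u v 2 →
    u ≡ v ⊎ Edge G u v ⊎ ∃ λ c → Edge G u c × Edge G c v
  DistLE2-cases (0 , (w , _) , _) = inj₁ (trans (sym (start w)) (end w))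
  DistLE2-cases (1 , (w , _) , _) = inj₂ (inj₁ (walk-edge w))
  DistLE2-cases (2 , (w , _) , _) = inj₂ (inj₂ (vert w (suc zero)
    , subst (λ u → Edge G u _) (start w) (step w zero)
    , subst (Edge G _) (end w) (step w (suc zero))))
  DistLE2-cases (suc (suc (suc _)) , _ , s≤s (s≤s ()))

  walk-invariant : ∀ (P : Fin n → Set) {u v} (w : Walk G k u v) →
    (∀ i → P (vert w (inject₁ i)) → P (vert w (suc i))) → P u → P v
  walk-invariant P w stepP Pu = subst P (end w)
    (<-weakInduction (P ∘ vert w) (subst P (sym (start w)) Pu) stepP _)

  ConnectedWithout⇒invariant : ∀ {x} → ConnectedWithout G x → (P : Fin n → Set) →
    (∀ {p q} → P p → Edge G p q → q ≢ x → P q) →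
    ∀ {u v} → u ≢ x → v ≢ x → P u → P v
  ConnectedWithout⇒invariant cw P closed u≢x v≢x with cw _ _ u≢x v≢x
  ... | _ , w , avoids = walk-invariant P w λ i Pi → closed Pi (step w i) (avoids (suc i))

  simpleCycle : ∀ {L} (vs : Vec (Fin n) (suc L)) → Unique vs → 2 ≤ L →
    (∀ i → Edge G (lookup (vs ∷ʳ head vs) (inject₁ i)) (lookup (vs ∷ʳ head vs) (suc i))) →
    SimpleCycle G (suc L)
  simpleCycle vs@(v ∷ _) unique 2≤L edges = record
    { base     = v
    ; walk     = record
      { vert = lookup (vs ∷ʳ v) ; start = refl ; end = lookup-∷ʳ-fromℕ vs v ; step = edges }
    ; len≥3    = s≤s 2≤L
    ; distinct = λ i j eq → lookup-injective unique i j (begin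
        lookup vs i                   ≡⟨ lookup-∷ʳ-inject₁ vs v i ⟨
        lookup (vs ∷ʳ v) (inject₁ i)  ≡⟨ eq ⟩
        lookup (vs ∷ʳ v) (inject₁ j)  ≡⟨ lookup-∷ʳ-inject₁ vs v j ⟩
        lookup vs j                   ∎)
    }
    where open ≡-Reasoning

  IsTheta⁰-intro : ∀ {a b} → n ≡ 2 + k → a ≢ b → ¬ Edge G a b →
    (∀ {c} → c ≢ a → c ≢ b → Edge G a c × Edge G c b) →
    (∀ {c d} → c ≢ a → c ≢ b → d ≢ a → d ≢ b → ¬ Edge G c d) →
    IsTheta G false k a b
  IsTheta⁰-intro {k} {a} {b} n≡2+k a≢b ¬ab spokes no-other-edge
    with π , π0≡a , π1≡b ← permutation-0↦a-1↦b n≡2+k a≢b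
    = π , π0≡a , π1≡b , adj-π
    where
    πᵢ≢a : ∀ i → π ⟨$⟩ʳ suc (suc i) ≢ a
    πᵢ≢a i eq with () ← Injection.injective (↔⇒↣ π) (trans eq (sym π0≡a))
    πᵢ≢b : ∀ i → π ⟨$⟩ʳ suc (suc i) ≢ b
    πᵢ≢b i eq with () ← Injection.injective (↔⇒↣ π) (trans eq (sym π1≡b))
    adj-π : ∀ x y → adj G (π ⟨$⟩ʳ x) (π ⟨$⟩ʳ y) ≡ thetaAdj false k x y
    adj-π zero          zero          = irrefl G _
    adj-π zero          (suc zero)    rewrite π0≡a | π1≡b = ¬-not ¬ab
    adj-π zero          (suc (suc j)) rewrite π0≡a = proj₁ (spokes (πᵢ≢a j) (πᵢ≢b j))
    adj-π (suc zero)    zero          rewrite π0≡a | π1≡b = ¬-not (¬ab ∘ Edge-sym)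
    adj-π (suc zero)    (suc zero)    = irrefl G _
    adj-π (suc zero)    (suc (suc j)) rewrite π1≡b = Edge-sym (proj₂ (spokes (πᵢ≢a j) (πᵢ≢b j)))
    adj-π (suc (suc i)) zero          rewrite π0≡a = Edge-sym (proj₁ (spokes (πᵢ≢a i) (πᵢ≢b i)))
    adj-π (suc (suc i)) (suc zero)    rewrite π1≡b = proj₂ (spokes (πᵢ≢a i) (πᵢ≢b i))
    adj-π (suc (suc i)) (suc (suc j)) =
      ¬-not (no-other-edge (πᵢ≢a i) (πᵢ≢b i) (πᵢ≢a j) (πᵢ≢b j))


module DegreeTwoNeighbourhood (G : Graph n) (v₀ : Fin n)
  (G-v₀-connected : ConnectedWithout G v₀)
  (cycles≤4 : ∀ L → SimpleCycle G L → L ≤ 4)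
  (radius≤2 : ∀ v → DistLE G v₀ v 2)
  (N : Subset n)
  (N⇔sphere₁ : ∀ v → (v ∈ N → Dist G v₀ v 1) × (Dist G v₀ v 1 → v ∈ N))
  (3≤∣N∣ : 3 ≤ ∣ N ∣)
  (deg≡2 : ∀ v → v ∈ N → deg G v ≡ 2)
  where

  ∈N⇒Edge : ∀ {v} → v ∈ N → Edge G v₀ v
  ∈N⇒Edge {v} v∈N = proj₁ (Dist1⇔Edge G) (proj₁ (N⇔sphere₁ v) v∈N)

  Edge⇒∈N : ∀ {v} → Edge G v₀ v → v ∈ N
  Edge⇒∈N {v} v₀v = proj₂ (N⇔sphere₁ v) (proj₂ (Dist1⇔Edge G) v₀v)

  ∈N⇒≢v₀ : ∀ {v} → v ∈ N → v ≢ v₀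
  ∈N⇒≢v₀ v∈N = Edge⇒≢ G (∈N⇒Edge v∈N) ∘ sym

  vertex-cases : ∀ v → v ≡ v₀ ⊎ v ∈ N ⊎ ∃ λ c → c ∈ N × Edge G c v
  vertex-cases v with DistLE2-cases G (radius≤2 v)
  ... | inj₁ v₀≡v                  = inj₁ (sym v₀≡v)
  ... | inj₂ (inj₁ v₀v)            = inj₂ (inj₁ (Edge⇒∈N v₀v))
  ... | inj₂ (inj₂ (c , v₀c , cv)) = inj₂ (inj₂ (c , Edge⇒∈N v₀c , cv))

  outer-neighbour-unique : ∀ {a y z} → a ∈ N → Edge G a y → Edge G a z → y ≢ v₀ → z ≢ v₀ → y ≡ z
  outer-neighbour-unique a∈N = other-neighbour-unique G (≤-reflexive (deg≡2 _ a∈N))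
                                 (Edge-sym G (∈N⇒Edge a∈N))

  N-independent : ∀ {a b} → a ∈ N → b ∈ N → ¬ Edge G a b
  N-independent {a} {b} a∈N b∈N ab
    with c , c∈N , c≢a , c≢b ← ∃∈-avoiding₂ 3≤∣N∣ a b
    with ConnectedWithout⇒invariant G G-v₀-connected (λ y → y ≡ a ⊎ y ≡ b) closed
           (∈N⇒≢v₀ a∈N) (∈N⇒≢v₀ c∈N) (inj₁ refl)
    where
    closed : ∀ {p q} → p ≡ a ⊎ p ≡ b → Edge G p q → q ≢ v₀ → q ≡ a ⊎ q ≡ b
    closed (inj₁ refl) pq q≢v₀ = inj₂ (outer-neighbour-unique a∈N pq ab q≢v₀ (∈N⇒≢v₀ b∈N))
    closed (inj₂ refl) pq q≢v₀ = inj₁ (outer-neighbour-unique b∈N pq (Edge-sym G ab) q≢v₀ (∈N⇒≢v₀ a∈N))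
  ... | inj₁ c≡a = c≢a c≡a
  ... | inj₂ c≡b = c≢b c≡b

  outer-neighbours-nonadjacent : ∀ {a b wa wb} → a ∈ N → b ∈ N → Edge G a wa → Edge G b wb →
    wa ≢ v₀ → wb ≢ v₀ → wa ≢ wb → ¬ Edge G wa wb
  outer-neighbours-nonadjacent {a} {b} {wa} {wb} a∈N b∈N a-wa b-wb wa≢v₀ wb≢v₀ wa≢wb wa-wb =
    <⇒≱ (s≤s (s≤s (s≤s (s≤s (s≤s z≤n))))) (cycles≤4 5 pentagon)
    where
    wa∉N : wa ∉ N
    wa∉N wa∈N = N-independent a∈N wa∈N a-wa
    wb∉N : wb ∉ N
    wb∉N wb∈N = N-independent b∈N wb∈N b-wb
    a≢b : a ≢ b
    a≢b refl = wa≢wb (outer-neighbour-unique a∈N a-wa b-wb wa≢v₀ wb≢v₀)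
    pentagon : SimpleCycle G 5
    pentagon = simpleCycle G (v₀ ∷ a ∷ wa ∷ wb ∷ b ∷ [])
      ( (∈N⇒≢v₀ a∈N ∘ sym ∷ wa≢v₀ ∘ sym ∷ wb≢v₀ ∘ sym ∷ ∈N⇒≢v₀ b∈N ∘ sym ∷ [])
      ∷ (Edge⇒≢ G a-wa ∷ x∈p∧y∉p⇒x≢y a∈N wb∉N ∷ a≢b ∷ [])
      ∷ (wa≢wb ∷ x∈p∧y∉p⇒x≢y b∈N wa∉N ∘ sym ∷ [])
      ∷ (Edge⇒≢ G b-wb ∘ sym ∷ [])
      ∷ [] ∷ [])
      (s≤s (s≤s z≤n))
      λ { zero → ∈N⇒Edge a∈N
        ; (suc zero) → a-wa
        ; (suc (suc zero)) → wa-wb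
        ; (suc (suc (suc zero))) → Edge-sym G b-wb
        ; (suc (suc (suc (suc zero)))) → Edge-sym G (∈N⇒Edge b∈N) }

  module Hub {a₀ x} (a₀∈N : a₀ ∈ N) (a₀x : Edge G a₀ x) (x≢v₀ : x ≢ v₀) where

    x∉N : x ∉ N
    x∉N x∈N = N-independent a₀∈N x∈N a₀x

    N-adjacent-to-x : ∀ {b} → b ∈ N → Edge G b x
    N-adjacent-to-x b∈N
      with ConnectedWithout⇒invariant G G-v₀-connected P closed
             (∈N⇒≢v₀ a₀∈N) (∈N⇒≢v₀ b∈N) (inj₂ (a₀∈N , a₀x))
      where
      P : Fin n → Set
      P y = y ≡ x ⊎ (y ∈ N × Edge G y x)
      closed : ∀ {p q} → P p → Edge G p q → q ≢ v₀ → P q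
      closed (inj₂ (p∈N , px)) pq q≢v₀ = inj₁ (outer-neighbour-unique p∈N pq px q≢v₀ x≢v₀)
      closed {q = q} (inj₁ refl) xq q≢v₀ with vertex-cases q
      ... | inj₁ q≡v₀ = contradiction q≡v₀ q≢v₀
      ... | inj₂ (inj₁ q∈N) = inj₂ (q∈N , Edge-sym G xq)
      ... | inj₂ (inj₂ (c , c∈N , cq)) with q ≟ x
      ...   | yes q≡x = inj₁ q≡x
      ...   | no  q≢x = contradiction xq
                          (outer-neighbours-nonadjacent a₀∈N c∈N a₀x cq x≢v₀ q≢v₀ (q≢x ∘ sym))
    ... | inj₁ b≡x        = contradiction b∈N (subst (_∉ N) (sym b≡x) x∉N)
    ... | inj₂ (_ , bx)   = bx

    vertex-trichotomy : ∀ v → v ≡ v₀ ⊎ v ∈ N ⊎ v ≡ x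
    vertex-trichotomy v with vertex-cases v
    ... | inj₁ v≡v₀                = inj₁ v≡v₀
    ... | inj₂ (inj₁ v∈N)          = inj₂ (inj₁ v∈N)
    ... | inj₂ (inj₂ (c , c∈N , cv)) with v ≟ v₀
    ...   | yes v≡v₀ = inj₁ v≡v₀
    ...   | no  v≢v₀ = inj₂ (inj₂ (outer-neighbour-unique c∈N cv (N-adjacent-to-x c∈N) v≢v₀ x≢v₀))

    others∈N : ∀ v → v ≢ v₀ → v ≢ x → v ∈ N
    others∈N v v≢v₀ v≢x with vertex-trichotomy v
    ... | inj₁ v≡v₀        = contradiction v≡v₀ v≢v₀
    ... | inj₂ (inj₁ v∈N)  = v∈N
    ... | inj₂ (inj₂ v≡x)  = contradiction v≡x v≢x

    outside-N∪v₀≡x : ∀ v → ((v ∉ N × v ≢ v₀) → v ≡ x) × (v ≡ x → (v ∉ N × v ≢ v₀))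
    outside-N∪v₀≡x v = only-x , λ { refl → x∉N , x≢v₀ }
      where
      only-x : v ∉ N × v ≢ v₀ → v ≡ x
      only-x (v∉N , v≢v₀) with v ≟ x
      ... | yes v≡x = v≡x
      ... | no  v≢x = contradiction (others∈N v v≢v₀ v≢x) v∉N

    IsTheta-v₀-x : IsTheta G false ∣ N ∣ v₀ x
    IsTheta-v₀-x = IsTheta⁰-intro G (n≡2+∣p∣ v₀≢x (λ v₀∈N → ∈N⇒≢v₀ v₀∈N refl) x∉N others∈N)
      v₀≢x (x∉N ∘ Edge⇒∈N)
      (λ {c} c≢v₀ c≢x → let c∈N = others∈N c c≢v₀ c≢x in ∈N⇒Edge c∈N , N-adjacent-to-x c∈N)
      (λ {c} {d} c≢v₀ c≢x d≢v₀ d≢x → N-independent (others∈N c c≢v₀ c≢x) (others∈N d d≢v₀ d≢x))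
      where
      v₀≢x : v₀ ≢ x
      v₀≢x = x≢v₀ ∘ sym

  theta-shape : ∃ λ vₓ → (∀ v → ((v ∉ N × v ≢ v₀) → v ≡ vₓ) × (v ≡ vₓ → (v ∉ N × v ≢ v₀)))
                       × IsTheta G false ∣ N ∣ v₀ vₓ
  theta-shape
    with a₀ , a₀∈N ← ∣p∣>0⇒Nonempty (≤-trans (s≤s z≤n) 3≤∣N∣)
    with x , a₀x , x≢v₀ ← other-neighbour G (≤-reflexive (sym (deg≡2 a₀ a₀∈N))) v₀
    = x , outside-N∪v₀≡x , IsTheta-v₀-x
    where open Hub a₀∈N a₀x x≢v₀

-- Connectivity of G is implied by that of G − v₀ (as N ≠ ∅).
mainTheorem3 : ∀ {n : ℕ} (G : Graph n) (v₀ : Fin n) →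
    Connected G →
    ConnectedWithout G v₀ →
    (∀ (L : ℕ) → SimpleCycle G L → L ≤ 4) →
    (∀ (v : Fin n) → DistLE G v₀ v 2) →
    (N : Subset n) →
    (∀ (v : Fin n) → (v ∈ N → Dist G v₀ v 1) × (Dist G v₀ v 1 → v ∈ N)) →
    3 ≤ ∣ N ∣ →
    (∀ (v : Fin n) → v ∈ N → deg G v ≡ 2) →
    ∃ λ (vₓ : Fin n) →
      (∀ (v : Fin n) → ((v ∉ N × v ≢ v₀) → v ≡ vₓ) × (v ≡ vₓ → (v ∉ N × v ≢ v₀))) ×
      IsTheta G false ∣ N ∣ v₀ vₓ
mainTheorem3 G v₀ _ = DegreeTwoNeighbourhood.theta-shape G v₀
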